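{- Let $F$ be a closed formula of the logic and let $\pi$ be a permutation of the nominal constants. Then $F$ is valid if and only if $\pi(F)$ is valid.
   Context: The logic is parameterized by a fixed well-formed canonical LF signature $\Sigma$ and a set $\mathcal{N}$ of nominal constants with arity types ($\alpha ::= o\mid\alpha\to\alpha$), countably infinitely many of each arity type. Terms $M ::= R\mid\lambda x.M$, $R ::= c\mid x\mid n\mid R\,M$; types $A ::= P\mid\Pi x{:}A_1.A_2$, $P ::= a\mid P\,M$ ($n$ nominal constants). Hereditary substitution $\theta(E)\rightsquigarrow E'$ (simultaneous replacement with normalization, indexed by arity types) and erasure $A^-$ are as in canonical LF. Context expressions $G ::= \cdot\mid\Gamma\mid G,n{:}A$ ($\Gamma$ a context variable). Formulas $F ::= \{G\vdash M:A\}\mid\top\mid\bot\mid F_1\supset F_2\mid F_1\wedge F_2\mid F_1\vee F_2\mid\Pi\Gamma{:}\mathcal{C}.F\mid\forall x{:}\alpha.F\mid\exists x{:}\alpha.F$. A block schema is $\{x_1{:}\alpha_1,\dots,x_m{:}\alpha_m\}(y_1{:}A_1,\dots,y_k{:}A_k)$ (distinct variables, types arity-well-formed), and a context schema $\mathcal{C}$ is a finite list of block schemas. A closed context expression $G$ is an instance of $\mathcal{C}$ if it is a concatenation of zero or more blocks, each obtained from some block schema of $\mathcal{C}$ by choosing nominal constants $n_j$ of arity type $A_j^-$, replacing each $y_j$ by $n_j$ (giving bindings $n_j{:}A_j'$), and replacing each $x_i$ by a closed term of arity type $\alpha_i$ built from $\Sigma$'s constants and nominal constants (via hereditary substitution).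 A formula is closed if it has no free term or context variables and satisfies the arity typing (canonicity) conditions: in $\{G\vdash M:A\}$, $M$ has arity type $A^-$, $A$ and the types in $G$ are arity-well-formed and each binding $n{:}B$ has $n$ of arity type $B^-$. Validity of closed formulas: $\top$ valid, $\bot$ not; $\{G\vdash M:A\}$ is valid iff $\vdash G\ \mathsf{ctx}$, $G\vdash A\ \mathsf{type}$ and $G\vdash M\Leftarrow A$ are derivable in canonical LF with nominal constants as context variables (the $\Pi$-kind, $\Pi$-type and $\lambda$ rules introducing a fresh nominal constant for the bound variable); connectives are interpreted classically as usual ($F_1\supset F_2$ valid if $F_2$ is valid whenever $F_1$ is, etc.); $\Pi\Gamma{:}\mathcal{C}.F$ is valid iff $F[G/\Gamma]$ is valid for every closed instance $G$ of $\mathcal{C}$; $\forall x{:}\alpha.F$ (resp. $\exists x{:}\alpha.F$) is valid iff $\{\langle x,M,\alpha\rangle\}(F)$ is valid for every (resp. some) closed term $M$ of arity type $\alpha$ over $\Sigma$ and $\mathcal{N}$. A permutation $\pi$ is an arity-type-preserving bijection on $\mathcal{N}$ differing from the identity on finitely many constants; $\pi(F)$ replaces every nominal constant $n$ in $F$ (including in bindings $n{:}A$ of context expressions) by $\pi(n)$. -}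

module Defs where

open import Data.Nat using (ℕ; zero; suc)
open import Data.Fin using (Fin; zero; suc)
open import Data.Vec using (Vec; []; _∷_; lookup)
open import Data.List using (List; []; _∷_; _++_; map; [_])
open import Data.List.Membership.Propositional using (_∈_; _∉_)
open import Data.List.Relation.Unary.All using (All)
open import Data.Product using (_×_; _,_; proj₁; proj₂; ∃; Σ-syntax)
open import Data.Sum using (_⊎_; inj₁; inj₂; [_,_]′)
import Data.Sum as Sum
open import Data.Unit using (⊤)
open import Data.Empty using (⊥)
open import Relation.Binary.PropositionalEquality using (_≡_)

infixr 5 _⇒_
data Ar : Set where
  o   : Ar
  _⇒_ : Ar → Ar → Ar

-- Nominal constants: countably infinitely many of each arity type.
-- The nominal constant (α , k) has arity type α.
Nom : Set
Nom = Ar × ℕ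

arity : Nom → Ar
arity = proj₁

Name : Set
Name = ℕ

-- Canonical LF syntax, well-scoped de Bruijn (scope n = # bound variables)

mutual
  data Tm (n : ℕ) : Set where
    atm : Atm n → Tm n
    lam : Tm (suc n) → Tm n

  data Atm (n : ℕ) : Set where
    con : Name → Atm n
    var : Fin n → Atm n
    nom : Nom → Atm n
    app : Atm n → Tm n → Atm n

data ATy (n : ℕ) : Set where
  fam  : Name → ATy n
  tapp : ATy n → Tm n → ATy n

data LTy (n : ℕ) : Set where
  base : ATy n → LTy n
  pi   : LTy n → LTy (suc n) → LTy n

data Kind (n : ℕ) : Set where
  type : Kind n
  kpi  : LTy n → Kind (suc n) → Kind n

er : ∀ {n} → LTy n → Ar
er (base P) = o
er (pi A B) = er A ⇒ er B

erK : ∀ {n} → Kind n → List Ar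
erK type      = []
erK (kpi A K) = er A ∷ erK K

Ren : ℕ → ℕ → Set
Ren n m = Fin n → Fin m ⊎ Nom

liftR : ∀ {n m} → Ren n m → Ren (suc n) (suc m)
liftR ρ zero    = inj₁ zero
liftR ρ (suc i) = Sum.map₁ suc (ρ i)

mutual
  renT : ∀ {n m} → Ren n m → Tm n → Tm m
  renT ρ (atm R) = atm (renA ρ R)
  renT ρ (lam M) = lam (renT (liftR ρ) M)

  renA : ∀ {n m} → Ren n m → Atm n → Atm m
  renA ρ (con c)   = con c
  renA ρ (var i)   = [ var , nom ]′ (ρ i)
  renA ρ (nom a)   = nom a
  renA ρ (app R M) = app (renA ρ R) (renT ρ M)

renP : ∀ {n m} → Ren n m → ATy n → ATy m
renP ρ (fam a)    = fam a
renP ρ (tapp P M) = tapp (renP ρ P) (renT ρ M)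

renTy : ∀ {n m} → Ren n m → LTy n → LTy m
renTy ρ (base P) = base (renP ρ P)
renTy ρ (pi A B) = pi (renTy ρ A) (renTy (liftR ρ) B)

renK : ∀ {n m} → Ren n m → Kind n → Kind m
renK ρ type      = type
renK ρ (kpi A K) = kpi (renTy ρ A) (renK (liftR ρ) K)

inst1 : ∀ {m} → Nom → Ren (suc m) m
inst1 a zero    = inj₂ a
inst1 a (suc i) = inj₁ i

openT : Nom → Tm 1 → Tm 0
openT a = renT (inst1 a)

openTy : Nom → LTy 1 → LTy 0
openTy a = renTy (inst1 a)

openK : Nom → Kind 1 → Kind 0
openK a = renK (inst1 a)

wk : ∀ {m} → Ren m (suc m)
wk i = inj₁ (suc i)

-- Hereditary substitution  θ(E) ⇝ E'  (simultaneous, indexed by arity types)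

-- an entry of a simultaneous substitution: a variable is either renamed
-- (to a variable or a nominal constant) or replaced by ⟨M, α⟩
data SE (m : ℕ) : Set where
  rn : Fin m ⊎ Nom → SE m
  tm : Ar → Tm m → SE m

Sub : ℕ → ℕ → Set
Sub n m = Fin n → SE m

wkSE : ∀ {m} → SE m → SE (suc m)
wkSE (rn x)   = rn (Sum.map₁ suc x)
wkSE (tm α M) = tm α (renT wk M)

liftS : ∀ {n m} → Sub n m → Sub (suc n) (suc m)
liftS σ zero    = rn (inj₁ zero)
liftS σ (suc i) = wkSE (σ i)

single : ∀ {m} → Ar → Tm m → Sub (suc m) m
single α M zero    = tm α M
single α M (suc i) = rn (inj₁ i)

ext : ∀ {n} {X : Set} → (Fin n → X) → X → Fin (suc n) → X
ext f x zero    = x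
ext f x (suc i) = f i

mutual
  -- θ(R) ⇝ R'  (head not replaced by a term)
  data HA : ∀ {n m} → Sub n m → Atm n → Atm m → Set where
    ha-con  : ∀ {n m} {σ : Sub n m} {c} → HA σ (con c) (con c)
    ha-nom  : ∀ {n m} {σ : Sub n m} {a} → HA σ (nom a) (nom a)
    ha-var  : ∀ {n m} {σ : Sub n m} {i j} → σ i ≡ rn (inj₁ j) → HA σ (var i) (var j)
    ha-varn : ∀ {n m} {σ : Sub n m} {i a} → σ i ≡ rn (inj₂ a) → HA σ (var i) (nom a)
    ha-app  : ∀ {n m} {σ : Sub n m} {R R' M M'} →
              HA σ R R' → HT σ M M' → HA σ (app R M) (app R' M')

  -- θ(R) ⇝ M : α  (head replaced, redexes contracted hereditarily)
  data HR : ∀ {n m} → Sub n m → Atm n → Tm m → Ar → Set where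
    hr-var : ∀ {n m} {σ : Sub n m} {i α M} → σ i ≡ tm α M → HR σ (var i) M α
    hr-app : ∀ {n m} {σ : Sub n m} {R M M' α₁ α₂} {M₀ : Tm (suc m)} {M'' : Tm m} →
             HR σ R (lam M₀) (α₁ ⇒ α₂) → HT σ M M' → HT (single α₁ M') M₀ M'' →
             HR σ (app R M) M'' α₂

  data HT : ∀ {n m} → Sub n m → Tm n → Tm m → Set where
    ht-atm : ∀ {n m} {σ : Sub n m} {R R'} → HA σ R R' → HT σ (atm R) (atm R')
    ht-red : ∀ {n m} {σ : Sub n m} {R M α} → HR σ R M α → HT σ (atm R) M
    ht-lam : ∀ {n m} {σ : Sub n m} {M M'} → HT (liftS σ) M M' → HT σ (lam M) (lam M')

data HP : ∀ {n m} → Sub n m → ATy n → ATy m → Set where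
  hp-fam : ∀ {n m} {σ : Sub n m} {a} → HP σ (fam a) (fam a)
  hp-app : ∀ {n m} {σ : Sub n m} {P P' M M'} → HP σ P P' → HT σ M M' → HP σ (tapp P M) (tapp P' M')

data HTy : ∀ {n m} → Sub n m → LTy n → LTy m → Set where
  hty-base : ∀ {n m} {σ : Sub n m} {P P'} → HP σ P P' → HTy σ (base P) (base P')
  hty-pi   : ∀ {n m} {σ : Sub n m} {A A' B B'} → HTy σ A A' → HTy (liftS σ) B B' →
             HTy σ (pi A B) (pi A' B')

data HK : ∀ {n m} → Sub n m → Kind n → Kind m → Set where
  hk-type : ∀ {n m} {σ : Sub n m} → HK σ type type
  hk-pi   : ∀ {n m} {σ : Sub n m} {A A' K K'} → HTy σ A A' → HK (liftS σ) K K' →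
            HK σ (kpi A K) (kpi A' K')

mutual
  nomsT : ∀ {n} → Tm n → List Nom
  nomsT (atm R) = nomsA R
  nomsT (lam M) = nomsT M

  nomsA : ∀ {n} → Atm n → List Nom
  nomsA (con c)   = []
  nomsA (var i)   = []
  nomsA (nom a)   = a ∷ []
  nomsA (app R M) = nomsA R ++ nomsT M

nomsP : ∀ {n} → ATy n → List Nom
nomsP (fam a)    = []
nomsP (tapp P M) = nomsP P ++ nomsT M

nomsTy : ∀ {n} → LTy n → List Nom
nomsTy (base P) = nomsP P
nomsTy (pi A B) = nomsTy A ++ nomsTy B

nomsK : ∀ {n} → Kind n → List Nom
nomsK type      = []
nomsK (kpi A K) = nomsTy A ++ nomsK K

-- closed LF contexts over nominal constants; head = most recent binding
CCtx : Set
CCtx = List (Nom × LTy 0)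

nomsC : CCtx → List Nom
nomsC []            = []
nomsC ((a , A) ∷ G) = a ∷ nomsTy A ++ nomsC G

dom : CCtx → List Nom
dom = map proj₁

data Decl : Set where
  objD : Name → LTy 0 → Decl
  famD : Name → Kind 0 → Decl

dname : Decl → Name
dname (objD c _) = c
dname (famD a _) = a

-- head = most recent declaration
Sig : Set
Sig = List Decl

-- Canonical LF judgments, relative to a signature, with nominal
-- constants playing the role of context variables.

module LF (Sg : Sig) where

  mutual
    data _⊢ₖ_ : CCtx → Kind 0 → Set where
      k-type : ∀ {G} → G ⊢ₖ type
      k-pi   : ∀ {G A K} (a : Nom) → G ⊢ₜ A →
               a ∉ nomsC G ++ nomsTy A ++ nomsK K → arity a ≡ er A →
               ((a , A) ∷ G) ⊢ₖ openK a K → G ⊢ₖ kpi A K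

    data _⊢ₜ_ : CCtx → LTy 0 → Set where
      t-base : ∀ {G P} → G ⊢ᵖ P ⇒ type → G ⊢ₜ base P
      t-pi   : ∀ {G A B} (a : Nom) → G ⊢ₜ A →
               a ∉ nomsC G ++ nomsTy A ++ nomsTy B → arity a ≡ er A →
               ((a , A) ∷ G) ⊢ₜ openTy a B → G ⊢ₜ pi A B

    data _⊢ᵖ_⇒_ : CCtx → ATy 0 → Kind 0 → Set where
      p-fam : ∀ {G a K} → famD a K ∈ Sg → G ⊢ᵖ fam a ⇒ K
      p-app : ∀ {G P A K M K'} → G ⊢ᵖ P ⇒ kpi A K → G ⊢ M ⇐ A →
              HK (single (er A) M) K K' → G ⊢ᵖ tapp P M ⇒ K'

    data _⊢ʳ_⇒_ : CCtx → Atm 0 → LTy 0 → Set where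
      r-con : ∀ {G c A} → objD c A ∈ Sg → G ⊢ʳ con c ⇒ A
      r-nom : ∀ {G a A} → (a , A) ∈ G → G ⊢ʳ nom a ⇒ A
      r-app : ∀ {G R A B M B'} → G ⊢ʳ R ⇒ pi A B → G ⊢ M ⇐ A →
              HTy (single (er A) M) B B' → G ⊢ʳ app R M ⇒ B'

    data _⊢_⇐_ : CCtx → Tm 0 → LTy 0 → Set where
      c-atm : ∀ {G R P P'} → G ⊢ʳ R ⇒ base P → P ≡ P' → G ⊢ atm R ⇐ base P'
      c-lam : ∀ {G M A B} (a : Nom) →
              a ∉ nomsC G ++ nomsT (lam M) ++ nomsTy A ++ nomsTy B → arity a ≡ er A →
              ((a , A) ∷ G) ⊢ openT a M ⇐ openTy a B → G ⊢ lam M ⇐ pi A B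

  data ⊢_ctx : CCtx → Set where
    ctx-nil  : ⊢ [] ctx
    ctx-cons : ∀ {G a A} → ⊢ G ctx → G ⊢ₜ A → a ∉ dom G → arity a ≡ er A →
               ⊢ ((a , A) ∷ G) ctx

data WfSig : Sig → Set where
  sig-nil : WfSig []
  sig-obj : ∀ {Sg c A} → WfSig Sg → LF._⊢ₜ_ Sg [] A → c ∉ map dname Sg →
            WfSig (objD c A ∷ Sg)
  sig-fam : ∀ {Sg a K} → WfSig Sg → LF._⊢ₖ_ Sg [] K → a ∉ map dname Sg →
            WfSig (famD a K ∷ Sg)

-- Formulas of the logic
-- Form c n : c = # context variables in scope, n = # term variables in scope

data CtxE (c n : ℕ) : Set where
  cnil  : CtxE c n
  cvar  : Fin c → CtxE c n
  ccons : CtxE c n → Nom → LTy n → CtxE c n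

data Tele (s : ℕ) : Set where
  tnil  : Tele s
  tcons : LTy s → Tele (suc s) → Tele s

-- block schema {x₁:α₁,…,x_m:α_m}(y₁:A₁,…,y_k:A_k)
record BSchema : Set where
  constructor bschema
  field
    m  : ℕ
    xs : Vec Ar m
    ys : Tele m

Schema : Set
Schema = List BSchema

data Form (c n : ℕ) : Set where
  atom  : CtxE c n → Tm n → LTy n → Form c n
  top   : Form c n
  bot   : Form c n
  imp   : Form c n → Form c n → Form c n
  conj  : Form c n → Form c n → Form c n
  disj  : Form c n → Form c n → Form c n
  ctxPi : Schema → Form (suc c) n → Form c n
  all   : Ar → Form c (suc n) → Form c n
  ex    : Ar → Form c (suc n) → Form c n

record Perm : Set where
  field
    fun     : Nom → Nom
    inv     : Nom → Nom
    inv-l   : ∀ a → inv (fun a) ≡ a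
    inv-r   : ∀ a → fun (inv a) ≡ a
    pres    : ∀ a → arity (fun a) ≡ arity a
    support : List Nom
    finite  : ∀ a → a ∉ support → fun a ≡ a

mutual
  pT : ∀ {n} → (Nom → Nom) → Tm n → Tm n
  pT f (atm R) = atm (pA f R)
  pT f (lam M) = lam (pT f M)

  pA : ∀ {n} → (Nom → Nom) → Atm n → Atm n
  pA f (con c)   = con c
  pA f (var i)   = var i
  pA f (nom a)   = nom (f a)
  pA f (app R M) = app (pA f R) (pT f M)

pP : ∀ {n} → (Nom → Nom) → ATy n → ATy n
pP f (fam a)    = fam a
pP f (tapp P M) = tapp (pP f P) (pT f M)

pTy : ∀ {n} → (Nom → Nom) → LTy n → LTy n
pTy f (base P) = base (pP f P)
pTy f (pi A B) = pi (pTy f A) (pTy f B)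

pCtxE : ∀ {c n} → (Nom → Nom) → CtxE c n → CtxE c n
pCtxE f cnil          = cnil
pCtxE f (cvar i)      = cvar i
pCtxE f (ccons G a A) = ccons (pCtxE f G) (f a) (pTy f A)

pTele : ∀ {s} → (Nom → Nom) → Tele s → Tele s
pTele f tnil        = tnil
pTele f (tcons A T) = tcons (pTy f A) (pTele f T)

pBS : (Nom → Nom) → BSchema → BSchema
pBS f (bschema m xs ys) = bschema m xs (pTele f ys)

pF : ∀ {c n} → (Nom → Nom) → Form c n → Form c n
pF f (atom G M A) = atom (pCtxE f G) (pT f M) (pTy f A)
pF f top          = top
pF f bot          = bot
pF f (imp F₁ F₂)  = imp (pF f F₁) (pF f F₂)
pF f (conj F₁ F₂) = conj (pF f F₁) (pF f F₂)
pF f (disj F₁ F₂) = disj (pF f F₁) (pF f F₂)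
pF f (ctxPi C F)  = ctxPi (map (pBS f) C) (pF f F)
pF f (all α F)    = all α (pF f F)
pF f (ex α F)     = ex α (pF f F)

permF : ∀ {c n} → Perm → Form c n → Form c n
permF π = pF (Perm.fun π)

module Logic (Sg : Sig) where
  open LF Sg public

  mutual
    data AAt : ∀ {n} → Vec Ar n → Atm n → Ar → Set where
      aa-con : ∀ {n} {Δ : Vec Ar n} {c A} → objD c A ∈ Sg → AAt Δ (con c) (er A)
      aa-var : ∀ {n} {Δ : Vec Ar n} {i} → AAt Δ (var i) (lookup Δ i)
      aa-nom : ∀ {n} {Δ : Vec Ar n} {a} → AAt Δ (nom a) (arity a)
      aa-app : ∀ {n} {Δ : Vec Ar n} {R M α β} → AAt Δ R (α ⇒ β) → ATm Δ M α →
               AAt Δ (app R M) β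

    -- Δ ⊢ M : α  (canonical = β-normal, η-long)
    data ATm : ∀ {n} → Vec Ar n → Tm n → Ar → Set where
      at-atm : ∀ {n} {Δ : Vec Ar n} {R} → AAt Δ R o → ATm Δ (atm R) o
      at-lam : ∀ {n} {Δ : Vec Ar n} {M α β} → ATm (α ∷ Δ) M β → ATm Δ (lam M) (α ⇒ β)

  -- arity well-formedness of atomic types (with remaining argument arities)
  data AwfP : ∀ {n} → Vec Ar n → ATy n → List Ar → Set where
    ap-fam : ∀ {n} {Δ : Vec Ar n} {a K} → famD a K ∈ Sg → AwfP Δ (fam a) (erK K)
    ap-app : ∀ {n} {Δ : Vec Ar n} {P M α αs} → AwfP Δ P (α ∷ αs) → ATm Δ M α →
             AwfP Δ (tapp P M) αs

  AwfTy : ∀ {n} → Vec Ar n → LTy n → Set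
  AwfTy Δ (base P) = AwfP Δ P []
  AwfTy Δ (pi A B) = AwfTy Δ A × AwfTy (er A ∷ Δ) B

  AwfTele : ∀ {s} → Vec Ar s → Tele s → Set
  AwfTele Δ tnil        = ⊤
  AwfTele Δ (tcons A T) = AwfTy Δ A × AwfTele (er A ∷ Δ) T

  AwfBS : BSchema → Set
  AwfBS (bschema m xs ys) = AwfTele xs ys

  AwfCtxE : ∀ {c n} → Vec Ar n → CtxE c n → Set
  AwfCtxE Δ cnil          = ⊤
  AwfCtxE Δ (cvar i)      = ⊤
  AwfCtxE Δ (ccons G a A) = AwfCtxE Δ G × AwfTy Δ A × arity a ≡ er A

  CF : ∀ {c n} → Vec Ar n → Form c n → Set
  CF Δ (atom G M A) = AwfCtxE Δ G × AwfTy Δ A × ATm Δ M (er A)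
  CF Δ top          = ⊤
  CF Δ bot          = ⊤
  CF Δ (imp F₁ F₂)  = CF Δ F₁ × CF Δ F₂
  CF Δ (conj F₁ F₂) = CF Δ F₁ × CF Δ F₂
  CF Δ (disj F₁ F₂) = CF Δ F₁ × CF Δ F₂
  CF Δ (ctxPi C F)  = All AwfBS C × CF Δ F
  CF Δ (all α F)    = CF (α ∷ Δ) F
  CF Δ (ex α F)     = CF (α ∷ Δ) F

  Closed : Form 0 0 → Set
  Closed F = CF [] F

  -- block instance: y's replaced by nominal constants, x's by closed terms
  data BInst : ∀ {s} → Sub s 0 → Tele s → CCtx → Set where
    bi-nil  : ∀ {s} {ρ : Sub s 0} → BInst ρ tnil []
    bi-cons : ∀ {s} {ρ : Sub s 0} {A A' T G} (a : Nom) →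
              HTy ρ A A' → arity a ≡ er A → BInst (ext ρ (rn (inj₂ a))) T G →
              BInst ρ (tcons A T) (G ++ [ (a , A') ])

  data Inst (C : Schema) : CCtx → Set where
    inst-nil  : Inst C []
    inst-cons : ∀ {G G'} (B : BSchema) → B ∈ C →
                (ts : Fin (BSchema.m B) → Tm 0) →
                (∀ i → ATm [] (ts i) (lookup (BSchema.xs B) i)) →
                BInst (λ i → tm (lookup (BSchema.xs B) i) (ts i)) (BSchema.ys B) G' →
                Inst C G → Inst C (G' ++ G)

  data InstC : ∀ {c n} → (Fin c → CCtx) → Sub n 0 → CtxE c n → CCtx → Set where
    ic-nil  : ∀ {c n} {γ : Fin c → CCtx} {θ : Sub n 0} → InstC γ θ cnil []
    ic-var  : ∀ {c n} {γ : Fin c → CCtx} {θ : Sub n 0} {i} → InstC γ θ (cvar i) (γ i)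
    ic-cons : ∀ {c n} {γ : Fin c → CCtx} {θ : Sub n 0} {G G' a A A'} →
              InstC γ θ G G' → HTy θ A A' → InstC γ θ (ccons G a A) ((a , A') ∷ G')

  -- validity of F under the pending substitutions γ (contexts for context
  -- variables) and θ (closed terms for term variables)
  Val : ∀ {c n} → (Fin c → CCtx) → Sub n 0 → Form c n → Set
  Val γ θ (atom G M A) =
    Σ[ G' ∈ CCtx ] Σ[ M' ∈ Tm 0 ] Σ[ A' ∈ LTy 0 ]
      (InstC γ θ G G' × HT θ M M' × HTy θ A A' ×
       ⊢ G' ctx × G' ⊢ₜ A' × G' ⊢ M' ⇐ A')
  Val γ θ top          = ⊤
  Val γ θ bot          = ⊥
  Val γ θ (imp F₁ F₂)  = Val γ θ F₁ → Val γ θ F₂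
  Val γ θ (conj F₁ F₂) = Val γ θ F₁ × Val γ θ F₂
  Val γ θ (disj F₁ F₂) = Val γ θ F₁ ⊎ Val γ θ F₂
  Val γ θ (ctxPi C F)  = ∀ G → Inst C G → Val (ext γ G) θ F
  Val γ θ (all α F)    = ∀ M → ATm [] M α → Val γ (ext θ (tm α M)) F
  Val γ θ (ex α F)     = Σ[ M ∈ Tm 0 ] (ATm [] M α × Val γ (ext θ (tm α M)) F)

  noCtx : Fin 0 → CCtx
  noCtx ()

  noTm : Sub 0 0
  noTm ()

  Valid : Form 0 0 → Set
  Valid F = Val noCtx noTm F

-- Everything in the logic treats nominal constants uniformly, so an injective,
-- arity-preserving renaming f of them commutes with renaming, opening and
-- hereditary substitution and sends fresh constants to fresh constants; hence it
-- maps every LF derivation over G to one over f(G). Signature constants are the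
-- only place where this could break, but their declared types and kinds are
-- fixed by f: they are well formed in the empty context, and every nominal
-- constant of a derivable judgment is declared in its context. Validity is then
-- preserved by induction on the formula; the term and context quantifiers range
-- over sets that π maps onto themselves, and each backward direction uses π⁻¹.
module Submission where

open import Defs
open import Data.Fin using (Fin; zero; suc)
open import Data.Vec using (Vec)
open import Data.List using (List; []; _∷_; _++_; map; [_])
open import Data.List.Properties using (map-++)
open import Data.List.Membership.Propositional using (_∈_; _∉_)
open import Data.List.Membership.Propositional.Properties using (∈-map⁺; ∈-map⁻; ∈-++⁺ˡ; ∈-++⁺ʳ; ∈-++⁻)
open import Data.List.Relation.Binary.Subset.Propositional using (_⊆_; _⊇_)
open import Data.List.Relation.Binary.Subset.Propositional.Properties using (⊆-trans; ++⁺; ⊆∷∧∉⇒⊆)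
open import Data.List.Relation.Unary.All using (All; []; _∷_; tabulate)
open import Data.List.Relation.Unary.All.Properties using (++⁻ˡ; ++⁻ʳ)
open import Data.List.Relation.Unary.Any using (here; there)
open import Data.List.Relation.Unary.Any.Properties using (¬Any[])
open import Data.Product using (_,_; proj₁)
import Data.Product as Product
open import Data.Product.Function.NonDependent.Propositional using (_×-⇔_)
open import Data.Sum using (inj₁; inj₂; [_,_]′)
import Data.Sum as Sum
open import Data.Sum.Function.Propositional using (_⊎-⇔_)
open import Data.Sum.Properties using ([,]-∘; [,]-map; map₁₂-map₂₁)
open import Data.Empty using (⊥-elim)
open import Function using (_∘_; _⇔_; mk⇔; Equivalence; Injective)
open import Function.Construct.Identity using (⇔-id)
open import Function.Related.TypeIsomorphisms using (→-cong-⇔)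
open import Relation.Binary.PropositionalEquality
  using (_≡_; refl; sym; trans; cong; cong₂; subst; subst₂; _≗_; module ≡-Reasoning)

pK : ∀ {n} → (Nom → Nom) → Kind n → Kind n
pK f type      = type
pK f (kpi A K) = kpi (pTy f A) (pK f K)

pC : (Nom → Nom) → CCtx → CCtx
pC f = map (Product.map f (pTy f))

pSE : ∀ {m} → (Nom → Nom) → SE m → SE m
pSE f (rn x)   = rn (Sum.map₂ f x)
pSE f (tm α M) = tm α (pT f M)

++-map : ∀ {A B : Set} (f : A → B) {xs ys xs′ ys′} →
         xs′ ≡ map f xs → ys′ ≡ map f ys → xs′ ++ ys′ ≡ map f (xs ++ ys)
++-map f {xs} {ys} refl refl = sym (map-++ f xs ys)

++⊆ : ∀ {A : Set} {xs ys zs : List A} → xs ⊆ zs → ys ⊆ zs → xs ++ ys ⊆ zs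
++⊆ {xs = xs} xs⊆zs ys⊆zs x∈ = [ xs⊆zs , ys⊆zs ]′ (∈-++⁻ xs x∈)

∉-map : ∀ {A B : Set} {f : A → B} → Injective _≡_ _≡_ f →
        ∀ {x xs} → x ∉ xs → f x ∉ map f xs
∉-map {f = f} inj x∉ fx∈ with ∈-map⁻ f fx∈
... | y , y∈ , fx≡fy rewrite inj fx≡fy = x∉ y∈

ext-≗ : ∀ {n} {X Y : Set} {h : X → Y} {γ : Fin n → X} {γ′ : Fin n → Y} {x y} →
        γ′ ≗ h ∘ γ → y ≡ h x → ext γ′ y ≗ h ∘ ext γ x
ext-≗ γ≗ y≡ zero    = y≡
ext-≗ γ≗ y≡ (suc i) = γ≗ i

invert-≗ : ∀ {Z X Y : Set} {h : X → Y} {k : Y → X} → (∀ x → k (h x) ≡ x) →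
           {γ : Z → X} {γ′ : Z → Y} → γ′ ≗ h ∘ γ → γ ≗ k ∘ γ′
invert-≗ {k = k} k∘h γ≗ i = trans (sym (k∘h _)) (cong k (sym (γ≗ i)))

module _ (f : Nom → Nom) where

  mutual
    nomsT-pT : ∀ {n} (M : Tm n) → nomsT (pT f M) ≡ map f (nomsT M)
    nomsT-pT (atm R) = nomsA-pA R
    nomsT-pT (lam M) = nomsT-pT M

    nomsA-pA : ∀ {n} (R : Atm n) → nomsA (pA f R) ≡ map f (nomsA R)
    nomsA-pA (con c)   = refl
    nomsA-pA (var i)   = refl
    nomsA-pA (nom a)   = refl
    nomsA-pA (app R M) = ++-map f (nomsA-pA R) (nomsT-pT M)

  nomsP-pP : ∀ {n} (P : ATy n) → nomsP (pP f P) ≡ map f (nomsP P)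
  nomsP-pP (fam a)    = refl
  nomsP-pP (tapp P M) = ++-map f (nomsP-pP P) (nomsT-pT M)

  nomsTy-pTy : ∀ {n} (A : LTy n) → nomsTy (pTy f A) ≡ map f (nomsTy A)
  nomsTy-pTy (base P) = nomsP-pP P
  nomsTy-pTy (pi A B) = ++-map f (nomsTy-pTy A) (nomsTy-pTy B)

  nomsK-pK : ∀ {n} (K : Kind n) → nomsK (pK f K) ≡ map f (nomsK K)
  nomsK-pK type      = refl
  nomsK-pK (kpi A K) = ++-map f (nomsTy-pTy A) (nomsK-pK K)

  nomsC-pC : ∀ G → nomsC (pC f G) ≡ map f (nomsC G)
  nomsC-pC []            = refl
  nomsC-pC ((a , A) ∷ G) = cong (f a ∷_) (++-map f (nomsTy-pTy A) (nomsC-pC G))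

  dom-pC : ∀ G → dom (pC f G) ≡ map f (dom G)
  dom-pC []            = refl
  dom-pC ((a , A) ∷ G) = cong (f a ∷_) (dom-pC G)

  er-pTy : ∀ {n} (A : LTy n) → er (pTy f A) ≡ er A
  er-pTy (base P) = refl
  er-pTy (pi A B) = cong₂ _⇒_ (er-pTy A) (er-pTy B)

  -- Substitutions are related to their images pointwise: liftR and liftS commute
  -- with the action of f only up to propositional equality.
  liftR-≗ : ∀ {n m} {ρ ρ′ : Ren n m} → ρ′ ≗ Sum.map₂ f ∘ ρ → liftR ρ′ ≗ Sum.map₂ f ∘ liftR ρ
  liftR-≗ ρ≗ zero            = refl
  liftR-≗ {ρ = ρ} ρ≗ (suc i) = trans (cong (Sum.map₁ suc) (ρ≗ i)) (map₁₂-map₂₁ (ρ i))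

  inst1-≗ : ∀ {m} a → inst1 {m} (f a) ≗ Sum.map₂ f ∘ inst1 a
  inst1-≗ a zero    = refl
  inst1-≗ a (suc i) = refl

  mutual
    pT-renT : ∀ {n m} {ρ ρ′ : Ren n m} → ρ′ ≗ Sum.map₂ f ∘ ρ →
              ∀ M → pT f (renT ρ M) ≡ renT ρ′ (pT f M)
    pT-renT ρ≗ (atm R) = cong atm (pA-renA ρ≗ R)
    pT-renT ρ≗ (lam M) = cong lam (pT-renT (liftR-≗ ρ≗) M)

    pA-renA : ∀ {n m} {ρ ρ′ : Ren n m} → ρ′ ≗ Sum.map₂ f ∘ ρ →
              ∀ R → pA f (renA ρ R) ≡ renA ρ′ (pA f R)
    pA-renA ρ≗ (con c) = refl
    pA-renA {ρ = ρ} {ρ′} ρ≗ (var i) = begin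
      pA f ([ var , nom ]′ (ρ i))        ≡⟨ [,]-∘ (pA f) (ρ i) ⟩
      [ var , nom ∘ f ]′ (ρ i)           ≡⟨ [,]-map (ρ i) ⟨
      [ var , nom ]′ (Sum.map₂ f (ρ i))  ≡⟨ cong [ var , nom ]′ (ρ≗ i) ⟨
      [ var , nom ]′ (ρ′ i)              ∎
      where open ≡-Reasoning
    pA-renA ρ≗ (nom a)   = refl
    pA-renA ρ≗ (app R M) = cong₂ app (pA-renA ρ≗ R) (pT-renT ρ≗ M)

  pP-renP : ∀ {n m} {ρ ρ′ : Ren n m} → ρ′ ≗ Sum.map₂ f ∘ ρ →
            ∀ P → pP f (renP ρ P) ≡ renP ρ′ (pP f P)
  pP-renP ρ≗ (fam a)    = refl
  pP-renP ρ≗ (tapp P M) = cong₂ tapp (pP-renP ρ≗ P) (pT-renT ρ≗ M)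

  pTy-renTy : ∀ {n m} {ρ ρ′ : Ren n m} → ρ′ ≗ Sum.map₂ f ∘ ρ →
              ∀ A → pTy f (renTy ρ A) ≡ renTy ρ′ (pTy f A)
  pTy-renTy ρ≗ (base P) = cong base (pP-renP ρ≗ P)
  pTy-renTy ρ≗ (pi A B) = cong₂ pi (pTy-renTy ρ≗ A) (pTy-renTy (liftR-≗ ρ≗) B)

  pK-renK : ∀ {n m} {ρ ρ′ : Ren n m} → ρ′ ≗ Sum.map₂ f ∘ ρ →
            ∀ K → pK f (renK ρ K) ≡ renK ρ′ (pK f K)
  pK-renK ρ≗ type      = refl
  pK-renK ρ≗ (kpi A K) = cong₂ kpi (pTy-renTy ρ≗ A) (pK-renK (liftR-≗ ρ≗) K)

  wkSE-pSE : ∀ {m} (e : SE m) → wkSE (pSE f e) ≡ pSE f (wkSE e)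
  wkSE-pSE (rn (inj₁ i)) = refl
  wkSE-pSE (rn (inj₂ a)) = refl
  wkSE-pSE (tm α M)      = cong (tm α) (sym (pT-renT (λ _ → refl) M))

  liftS-≗ : ∀ {n m} {σ σ′ : Sub n m} → σ′ ≗ pSE f ∘ σ → liftS σ′ ≗ pSE f ∘ liftS σ
  liftS-≗ σ≗ zero            = refl
  liftS-≗ {σ = σ} σ≗ (suc i) = trans (cong wkSE (σ≗ i)) (wkSE-pSE (σ i))

  single-≗ : ∀ {m α α′} (M : Tm m) → α′ ≡ α → single α′ (pT f M) ≗ pSE f ∘ single α M
  single-≗ M refl zero    = refl
  single-≗ M refl (suc i) = refl

  mutual
    HA-pA : ∀ {n m} {σ σ′ : Sub n m} {R R′} → σ′ ≗ pSE f ∘ σ →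
            HA σ R R′ → HA σ′ (pA f R) (pA f R′)
    HA-pA σ≗ ha-con              = ha-con
    HA-pA σ≗ ha-nom              = ha-nom
    HA-pA σ≗ (ha-var {i = i} e)  = ha-var (trans (σ≗ i) (cong (pSE f) e))
    HA-pA σ≗ (ha-varn {i = i} e) = ha-varn (trans (σ≗ i) (cong (pSE f) e))
    HA-pA σ≗ (ha-app hR hM)      = ha-app (HA-pA σ≗ hR) (HT-pT σ≗ hM)

    HR-pA : ∀ {n m} {σ σ′ : Sub n m} {R M α} → σ′ ≗ pSE f ∘ σ →
            HR σ R M α → HR σ′ (pA f R) (pT f M) α
    HR-pA σ≗ (hr-var {i = i} e) = hr-var (trans (σ≗ i) (cong (pSE f) e))
    HR-pA σ≗ (hr-app hR hM hβ)  =
      hr-app (HR-pA σ≗ hR) (HT-pT σ≗ hM) (HT-pT (single-≗ _ refl) hβ)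

    HT-pT : ∀ {n m} {σ σ′ : Sub n m} {M M′} → σ′ ≗ pSE f ∘ σ →
            HT σ M M′ → HT σ′ (pT f M) (pT f M′)
    HT-pT σ≗ (ht-atm hR) = ht-atm (HA-pA σ≗ hR)
    HT-pT σ≗ (ht-red hR) = ht-red (HR-pA σ≗ hR)
    HT-pT σ≗ (ht-lam hM) = ht-lam (HT-pT (liftS-≗ σ≗) hM)

  HP-pP : ∀ {n m} {σ σ′ : Sub n m} {P P′} → σ′ ≗ pSE f ∘ σ →
          HP σ P P′ → HP σ′ (pP f P) (pP f P′)
  HP-pP σ≗ hp-fam         = hp-fam
  HP-pP σ≗ (hp-app hP hM) = hp-app (HP-pP σ≗ hP) (HT-pT σ≗ hM)

  HTy-pTy : ∀ {n m} {σ σ′ : Sub n m} {A A′} → σ′ ≗ pSE f ∘ σ →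
            HTy σ A A′ → HTy σ′ (pTy f A) (pTy f A′)
  HTy-pTy σ≗ (hty-base hP)  = hty-base (HP-pP σ≗ hP)
  HTy-pTy σ≗ (hty-pi hA hB) = hty-pi (HTy-pTy σ≗ hA) (HTy-pTy (liftS-≗ σ≗) hB)

  HK-pK : ∀ {n m} {σ σ′ : Sub n m} {K K′} → σ′ ≗ pSE f ∘ σ →
          HK σ K K′ → HK σ′ (pK f K) (pK f K′)
  HK-pK σ≗ hk-type       = hk-type
  HK-pK σ≗ (hk-pi hA hK) = hk-pi (HTy-pTy σ≗ hA) (HK-pK (liftS-≗ σ≗) hK)

  Fixed : List Nom → Set
  Fixed = All (λ a → f a ≡ a)

  mutual
    pT-id-local : ∀ {n} (M : Tm n) → Fixed (nomsT M) → pT f M ≡ M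
    pT-id-local (atm R) fix = cong atm (pA-id-local R fix)
    pT-id-local (lam M) fix = cong lam (pT-id-local M fix)

    pA-id-local : ∀ {n} (R : Atm n) → Fixed (nomsA R) → pA f R ≡ R
    pA-id-local (con c) fix         = refl
    pA-id-local (var i) fix         = refl
    pA-id-local (nom a) (fa≡a ∷ []) = cong nom fa≡a
    pA-id-local (app R M) fix       =
      cong₂ app (pA-id-local R (++⁻ˡ (nomsA R) fix)) (pT-id-local M (++⁻ʳ (nomsA R) fix))

  pP-id-local : ∀ {n} (P : ATy n) → Fixed (nomsP P) → pP f P ≡ P
  pP-id-local (fam a) fix    = refl
  pP-id-local (tapp P M) fix =
    cong₂ tapp (pP-id-local P (++⁻ˡ (nomsP P) fix)) (pT-id-local M (++⁻ʳ (nomsP P) fix))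

  pTy-id-local : ∀ {n} (A : LTy n) → Fixed (nomsTy A) → pTy f A ≡ A
  pTy-id-local (base P) fix = cong base (pP-id-local P fix)
  pTy-id-local (pi A B) fix =
    cong₂ pi (pTy-id-local A (++⁻ˡ (nomsTy A) fix)) (pTy-id-local B (++⁻ʳ (nomsTy A) fix))

  pK-id-local : ∀ {n} (K : Kind n) → Fixed (nomsK K) → pK f K ≡ K
  pK-id-local type fix      = refl
  pK-id-local (kpi A K) fix =
    cong₂ kpi (pTy-id-local A (++⁻ˡ (nomsTy A) fix)) (pK-id-local K (++⁻ʳ (nomsTy A) fix))

  Fixed-⊆[] : ∀ {xs} → xs ⊆ [] → Fixed xs
  Fixed-⊆[] xs⊆[] = tabulate (λ a∈ → ⊥-elim (¬Any[] (xs⊆[] a∈)))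

module InverseAction {f g : Nom → Nom} (g∘f : ∀ a → g (f a) ≡ a) where

  mutual
    pT-inverse : ∀ {n} (M : Tm n) → pT g (pT f M) ≡ M
    pT-inverse (atm R) = cong atm (pA-inverse R)
    pT-inverse (lam M) = cong lam (pT-inverse M)

    pA-inverse : ∀ {n} (R : Atm n) → pA g (pA f R) ≡ R
    pA-inverse (con c)   = refl
    pA-inverse (var i)   = refl
    pA-inverse (nom a)   = cong nom (g∘f a)
    pA-inverse (app R M) = cong₂ app (pA-inverse R) (pT-inverse M)

  pP-inverse : ∀ {n} (P : ATy n) → pP g (pP f P) ≡ P
  pP-inverse (fam a)    = refl
  pP-inverse (tapp P M) = cong₂ tapp (pP-inverse P) (pT-inverse M)

  pTy-inverse : ∀ {n} (A : LTy n) → pTy g (pTy f A) ≡ A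
  pTy-inverse (base P) = cong base (pP-inverse P)
  pTy-inverse (pi A B) = cong₂ pi (pTy-inverse A) (pTy-inverse B)

  pTele-inverse : ∀ {s} (T : Tele s) → pTele g (pTele f T) ≡ T
  pTele-inverse tnil        = refl
  pTele-inverse (tcons A T) = cong₂ tcons (pTy-inverse A) (pTele-inverse T)

  map-pBS-inverse : (C : Schema) → map (pBS g) (map (pBS f) C) ≡ C
  map-pBS-inverse []                    = refl
  map-pBS-inverse (bschema m xs ys ∷ C) =
    cong₂ _∷_ (cong (bschema m xs) (pTele-inverse ys)) (map-pBS-inverse C)

  pCtxE-inverse : ∀ {c n} (G : CtxE c n) → pCtxE g (pCtxE f G) ≡ G
  pCtxE-inverse cnil     = refl
  pCtxE-inverse (cvar i) = refl
  pCtxE-inverse (ccons G a A)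
    rewrite pCtxE-inverse G | g∘f a | pTy-inverse A = refl

  pF-inverse : ∀ {c n} (F : Form c n) → pF g (pF f F) ≡ F
  pF-inverse (atom G M A)
    rewrite pCtxE-inverse G | pT-inverse M | pTy-inverse A = refl
  pF-inverse top          = refl
  pF-inverse bot          = refl
  pF-inverse (imp F₁ F₂)  = cong₂ imp (pF-inverse F₁) (pF-inverse F₂)
  pF-inverse (conj F₁ F₂) = cong₂ conj (pF-inverse F₁) (pF-inverse F₂)
  pF-inverse (disj F₁ F₂) = cong₂ disj (pF-inverse F₁) (pF-inverse F₂)
  pF-inverse (ctxPi C F)  = cong₂ ctxPi (map-pBS-inverse C) (pF-inverse F)
  pF-inverse (all α F)    = cong (all α) (pF-inverse F)
  pF-inverse (ex α F)     = cong (ex α) (pF-inverse F)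

  pC-inverse : (G : CCtx) → pC g (pC f G) ≡ G
  pC-inverse []            = refl
  pC-inverse ((a , A) ∷ G) = cong₂ _∷_ (cong₂ _,_ (g∘f a) (pTy-inverse A)) (pC-inverse G)

  pSE-inverse : ∀ {m} (e : SE m) → pSE g (pSE f e) ≡ e
  pSE-inverse (rn (inj₁ i)) = refl
  pSE-inverse (rn (inj₂ a)) = cong (rn ∘ inj₂) (g∘f a)
  pSE-inverse (tm α M)      = cong (tm α) (pT-inverse M)

mutual
  nomsT-renT-⊇ : ∀ {n m} (ρ : Ren n m) (M : Tm n) → nomsT (renT ρ M) ⊇ nomsT M
  nomsT-renT-⊇ ρ (atm R) = nomsA-renA-⊇ ρ R
  nomsT-renT-⊇ ρ (lam M) = nomsT-renT-⊇ (liftR ρ) M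

  nomsA-renA-⊇ : ∀ {n m} (ρ : Ren n m) (R : Atm n) → nomsA (renA ρ R) ⊇ nomsA R
  nomsA-renA-⊇ ρ (nom a) a∈   = a∈
  nomsA-renA-⊇ ρ (app R M)    = ++⁺ (nomsA-renA-⊇ ρ R) (nomsT-renT-⊇ ρ M)

nomsP-renP-⊇ : ∀ {n m} (ρ : Ren n m) (P : ATy n) → nomsP (renP ρ P) ⊇ nomsP P
nomsP-renP-⊇ ρ (tapp P M) = ++⁺ (nomsP-renP-⊇ ρ P) (nomsT-renT-⊇ ρ M)

nomsTy-renTy-⊇ : ∀ {n m} (ρ : Ren n m) (A : LTy n) → nomsTy (renTy ρ A) ⊇ nomsTy A
nomsTy-renTy-⊇ ρ (base P) = nomsP-renP-⊇ ρ P
nomsTy-renTy-⊇ ρ (pi A B) = ++⁺ (nomsTy-renTy-⊇ ρ A) (nomsTy-renTy-⊇ (liftR ρ) B)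

nomsK-renK-⊇ : ∀ {n m} (ρ : Ren n m) (K : Kind n) → nomsK (renK ρ K) ⊇ nomsK K
nomsK-renK-⊇ ρ (kpi A K) = ++⁺ (nomsTy-renTy-⊇ ρ A) (nomsK-renK-⊇ (liftR ρ) K)

module _ {Sg : Sig} where
  open LF Sg

  mutual
    nomsK⊆dom : ∀ {G K} → G ⊢ₖ K → nomsK K ⊆ dom G
    nomsK⊆dom (k-pi {G} {A} {K} a ⊢A a∉ _ ⊢K) =
      ++⊆ (nomsTy⊆dom ⊢A)
          (⊆∷∧∉⇒⊆ (⊆-trans (nomsK-renK-⊇ (inst1 a) K) (nomsK⊆dom ⊢K))
                  (a∉ ∘ ∈-++⁺ʳ (nomsC G) ∘ ∈-++⁺ʳ (nomsTy A)))

    nomsTy⊆dom : ∀ {G A} → G ⊢ₜ A → nomsTy A ⊆ dom G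
    nomsTy⊆dom (t-base ⊢P) = nomsP⊆dom ⊢P
    nomsTy⊆dom (t-pi {G} {A} {B} a ⊢A a∉ _ ⊢B) =
      ++⊆ (nomsTy⊆dom ⊢A)
          (⊆∷∧∉⇒⊆ (⊆-trans (nomsTy-renTy-⊇ (inst1 a) B) (nomsTy⊆dom ⊢B))
                  (a∉ ∘ ∈-++⁺ʳ (nomsC G) ∘ ∈-++⁺ʳ (nomsTy A)))

    nomsP⊆dom : ∀ {G P K} → G ⊢ᵖ P ⇒ K → nomsP P ⊆ dom G
    nomsP⊆dom (p-app ⊢P ⊢M _) = ++⊆ (nomsP⊆dom ⊢P) (nomsT⊆dom ⊢M)

    nomsA⊆dom : ∀ {G R A} → G ⊢ʳ R ⇒ A → nomsA R ⊆ dom G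
    nomsA⊆dom (r-nom a∈G) (here refl) = ∈-map⁺ proj₁ a∈G
    nomsA⊆dom (r-app ⊢R ⊢M _)         = ++⊆ (nomsA⊆dom ⊢R) (nomsT⊆dom ⊢M)

    nomsT⊆dom : ∀ {G M A} → G ⊢ M ⇐ A → nomsT M ⊆ dom G
    nomsT⊆dom (c-atm ⊢R _) = nomsA⊆dom ⊢R
    nomsT⊆dom (c-lam {G} {M} a a∉ _ ⊢M) =
      ⊆∷∧∉⇒⊆ (⊆-trans (nomsT-renT-⊇ (inst1 a) M) (nomsT⊆dom ⊢M))
              (a∉ ∘ ∈-++⁺ʳ (nomsC G) ∘ ∈-++⁺ˡ)

module _ (f : Nom → Nom) where

  pTy-sig-objD : ∀ {Sg c A} → WfSig Sg → objD c A ∈ Sg → pTy f A ≡ A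
  pTy-sig-objD (sig-obj {A = A} _ ⊢A _) (here refl) =
    pTy-id-local f A (Fixed-⊆[] f (nomsTy⊆dom ⊢A))
  pTy-sig-objD (sig-obj wf _ _) (there c∈) = pTy-sig-objD wf c∈
  pTy-sig-objD (sig-fam wf _ _) (there c∈) = pTy-sig-objD wf c∈

  pK-sig-famD : ∀ {Sg a K} → WfSig Sg → famD a K ∈ Sg → pK f K ≡ K
  pK-sig-famD (sig-fam {K = K} _ ⊢K _) (here refl) =
    pK-id-local f K (Fixed-⊆[] f (nomsK⊆dom ⊢K))
  pK-sig-famD (sig-obj wf _ _) (there a∈) = pK-sig-famD wf a∈
  pK-sig-famD (sig-fam wf _ _) (there a∈) = pK-sig-famD wf a∈

module _ {Sg : Sig} (f : Nom → Nom) where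
  open Logic Sg

  InstC-pC : ∀ {c n} {γ γ′ : Fin c → CCtx} {θ θ′ : Sub n 0} {G G′} →
             γ′ ≗ pC f ∘ γ → θ′ ≗ pSE f ∘ θ →
             InstC γ θ G G′ → InstC γ′ θ′ (pCtxE f G) (pC f G′)
  InstC-pC γ≗ θ≗ ic-nil          = ic-nil
  InstC-pC γ≗ θ≗ (ic-var {i = i}) = subst (InstC _ _ (cvar i)) (γ≗ i) ic-var
  InstC-pC γ≗ θ≗ (ic-cons ic hA)  = ic-cons (InstC-pC γ≗ θ≗ ic) (HTy-pTy f θ≗ hA)

arity-pTy : ∀ {f : Nom → Nom} → (∀ a → arity (f a) ≡ arity a) →
            ∀ {n a} (A : LTy n) → arity a ≡ er A → arity (f a) ≡ er (pTy f A)
arity-pTy {f} pres {a = a} A a:A = trans (pres a) (trans a:A (sym (er-pTy f A)))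

module _ {Sg : Sig} {f : Nom → Nom} (inj : Injective _≡_ _≡_ f)
         (pres : ∀ a → arity (f a) ≡ arity a) (wf : WfSig Sg) where
  open Logic Sg

  private
    fresh : ∀ {a xs ys} → a ∉ xs → ys ≡ map f xs → f a ∉ ys
    fresh a∉ refl = ∉-map inj a∉

  mutual
    ⊢ₖ-pK : ∀ {G K} → G ⊢ₖ K → pC f G ⊢ₖ pK f K
    ⊢ₖ-pK k-type = k-type
    ⊢ₖ-pK (k-pi {G} {A} {K} a ⊢A a∉ a:A ⊢K) =
      k-pi (f a) (⊢ₜ-pTy ⊢A)
        (fresh a∉ (++-map f (nomsC-pC f G) (++-map f (nomsTy-pTy f A) (nomsK-pK f K))))
        (arity-pTy pres A a:A)
        (subst (_ ⊢ₖ_) (pK-renK f (inst1-≗ f a) K) (⊢ₖ-pK ⊢K))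

    ⊢ₜ-pTy : ∀ {G A} → G ⊢ₜ A → pC f G ⊢ₜ pTy f A
    ⊢ₜ-pTy (t-base ⊢P) = t-base (⊢ᵖ-pP ⊢P)
    ⊢ₜ-pTy (t-pi {G} {A} {B} a ⊢A a∉ a:A ⊢B) =
      t-pi (f a) (⊢ₜ-pTy ⊢A)
        (fresh a∉ (++-map f (nomsC-pC f G) (++-map f (nomsTy-pTy f A) (nomsTy-pTy f B))))
        (arity-pTy pres A a:A)
        (subst (_ ⊢ₜ_) (pTy-renTy f (inst1-≗ f a) B) (⊢ₜ-pTy ⊢B))

    ⊢ᵖ-pP : ∀ {G P K} → G ⊢ᵖ P ⇒ K → pC f G ⊢ᵖ pP f P ⇒ pK f K
    ⊢ᵖ-pP (p-fam a∈) = subst (_ ⊢ᵖ _ ⇒_) (sym (pK-sig-famD f wf a∈)) (p-fam a∈)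
    ⊢ᵖ-pP (p-app {A = A} {M = M} ⊢P ⊢M hK) =
      p-app (⊢ᵖ-pP ⊢P) (⇐-pT ⊢M) (HK-pK f (single-≗ f M (er-pTy f A)) hK)

    ⊢ʳ-pA : ∀ {G R A} → G ⊢ʳ R ⇒ A → pC f G ⊢ʳ pA f R ⇒ pTy f A
    ⊢ʳ-pA (r-con c∈)  = subst (_ ⊢ʳ _ ⇒_) (sym (pTy-sig-objD f wf c∈)) (r-con c∈)
    ⊢ʳ-pA (r-nom a∈G) = r-nom (∈-map⁺ (Product.map f (pTy f)) a∈G)
    ⊢ʳ-pA (r-app {A = A} {M = M} ⊢R ⊢M hB) =
      r-app (⊢ʳ-pA ⊢R) (⇐-pT ⊢M) (HTy-pTy f (single-≗ f M (er-pTy f A)) hB)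

    ⇐-pT : ∀ {G M A} → G ⊢ M ⇐ A → pC f G ⊢ pT f M ⇐ pTy f A
    ⇐-pT (c-atm ⊢R refl) = c-atm (⊢ʳ-pA ⊢R) refl
    ⇐-pT (c-lam {G} {M} {A} {B} a a∉ a:A ⊢M) =
      c-lam (f a)
        (fresh a∉ (++-map f (nomsC-pC f G)
                    (++-map f (nomsT-pT f M) (++-map f (nomsTy-pTy f A) (nomsTy-pTy f B)))))
        (arity-pTy pres A a:A)
        (subst₂ (_ ⊢_⇐_) (pT-renT f (inst1-≗ f a) M) (pTy-renTy f (inst1-≗ f a) B) (⇐-pT ⊢M))

  ctx-pC : ∀ {G} → ⊢ G ctx → ⊢ pC f G ctx
  ctx-pC ctx-nil = ctx-nil
  ctx-pC (ctx-cons {G} {a} {A} ⊢G ⊢A a∉ a:A) =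
    ctx-cons (ctx-pC ⊢G) (⊢ₜ-pTy ⊢A) (fresh a∉ (dom-pC f G)) (arity-pTy pres A a:A)

  Val-atom-pF : ∀ {c n} (G : CtxE c n) M A {γ γ′ : Fin c → CCtx} {θ θ′ : Sub n 0} →
                γ′ ≗ pC f ∘ γ → θ′ ≗ pSE f ∘ θ →
                Val γ θ (atom G M A) → Val γ′ θ′ (pF f (atom G M A))
  Val-atom-pF G M A γ≗ θ≗ (G₀ , M₀ , A₀ , ic , hM , hA , ⊢G , ⊢A , ⊢M) =
    pC f G₀ , pT f M₀ , pTy f A₀ , InstC-pC f γ≗ θ≗ ic , HT-pT f θ≗ hM , HTy-pTy f θ≗ hA ,
    ctx-pC ⊢G , ⊢ₜ-pTy ⊢A , ⇐-pT ⊢M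

module _ {Sg : Sig} {f : Nom → Nom} (pres : ∀ a → arity (f a) ≡ arity a) where
  open Logic Sg

  mutual
    AAt-pA : ∀ {n} {Δ : Vec Ar n} {R α} → AAt Δ R α → AAt Δ (pA f R) α
    AAt-pA (aa-con c∈)      = aa-con c∈
    AAt-pA aa-var           = aa-var
    AAt-pA (aa-nom {a = a}) = subst (AAt _ (nom (f a))) (pres a) aa-nom
    AAt-pA (aa-app ⊢R ⊢M)   = aa-app (AAt-pA ⊢R) (ATm-pT ⊢M)

    ATm-pT : ∀ {n} {Δ : Vec Ar n} {M α} → ATm Δ M α → ATm Δ (pT f M) α
    ATm-pT (at-atm ⊢R) = at-atm (AAt-pA ⊢R)
    ATm-pT (at-lam ⊢M) = at-lam (ATm-pT ⊢M)

  BInst-pC : ∀ {s} {ρ ρ′ : Sub s 0} {T G} → ρ′ ≗ pSE f ∘ ρ →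
             BInst ρ T G → BInst ρ′ (pTele f T) (pC f G)
  BInst-pC ρ≗ bi-nil = bi-nil
  BInst-pC ρ≗ (bi-cons {A = A} {A′} {G = G} a hA a:A bi) =
    subst (BInst _ _) (sym (map-++ (Product.map f (pTy f)) G [ (a , A′) ]))
      (bi-cons (f a) (HTy-pTy f ρ≗ hA) (arity-pTy pres A a:A)
        (BInst-pC (ext-≗ {h = pSE f} ρ≗ refl) bi))

  Inst-pC : ∀ {C G} → Inst C G → Inst (map (pBS f) C) (pC f G)
  Inst-pC inst-nil = inst-nil
  Inst-pC (inst-cons {G} {G′} B B∈C ts ⊢ts bi inst) =
    subst (Inst _) (sym (map-++ (Product.map f (pTy f)) G′ G))
      (inst-cons (pBS f B) (∈-map⁺ (pBS f) B∈C) (pT f ∘ ts) (ATm-pT ∘ ⊢ts)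
        (BInst-pC (λ _ → refl) bi) (Inst-pC inst))

_⁻¹ : Perm → Perm
π ⁻¹ = record
  { fun = inv ; inv = fun ; inv-l = inv-r ; inv-r = inv-l
  ; pres = λ a → trans (sym (pres (inv a))) (cong arity (inv-r a))
  ; support = support
  ; finite = λ a a∉ → trans (cong inv (sym (finite a a∉))) (inv-l a)
  }
  where open Perm π

fun-injective : (π : Perm) → Injective _≡_ _≡_ (Perm.fun π)
fun-injective π {a} {b} πa≡πb = trans (sym (inv-l a)) (trans (cong inv πa≡πb) (inv-l b))
  where open Perm π

module _ {Sg : Sig} (wf : WfSig Sg) (π : Perm) where
  open Logic Sg
  open Perm π using (inv-l; inv-r; pres) renaming (fun to f; inv to g)
  open Perm (π ⁻¹) using () renaming (pres to inv-pres)
  open Equivalence using (to; from)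
  module g∘f = InverseAction {f} {g} inv-l
  module f∘g = InverseAction {g} {f} inv-r

  ext-γ : ∀ {c} {γ γ′ : Fin c → CCtx} {G G′} → γ′ ≗ pC f ∘ γ → G′ ≡ pC f G →
          ext γ′ G′ ≗ pC f ∘ ext γ G
  ext-γ = ext-≗ {h = pC f}

  ext-θ : ∀ {n} {θ θ′ : Sub n 0} {α M M′} → θ′ ≗ pSE f ∘ θ → M′ ≡ pT f M →
          ext θ′ (tm α M′) ≗ pSE f ∘ ext θ (tm α M)
  ext-θ {α = α} θ≗ M′≡ = ext-≗ {h = pSE f} θ≗ (cong (tm α) M′≡)

  Val-atom-pF⁻¹ : ∀ {c n} (G : CtxE c n) M A {γ γ′ : Fin c → CCtx} {θ θ′ : Sub n 0} →
                  γ′ ≗ pC f ∘ γ → θ′ ≗ pSE f ∘ θ →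
                  Val γ′ θ′ (pF f (atom G M A)) → Val γ θ (atom G M A)
  Val-atom-pF⁻¹ G M A {γ} {θ = θ} γ≗ θ≗ =
    subst (Val γ θ) (g∘f.pF-inverse (atom G M A))
    ∘ Val-atom-pF (fun-injective (π ⁻¹)) inv-pres wf (pCtxE f G) (pT f M) (pTy f A)
        (invert-≗ {h = pC f} {pC g} g∘f.pC-inverse γ≗)
        (invert-≗ {h = pSE f} {pSE g} g∘f.pSE-inverse θ≗)

  Inst-pC⁻¹ : ∀ {C G} → Inst (map (pBS f) C) G → Inst C (pC g G)
  Inst-pC⁻¹ {C} {G} =
    subst (λ C′ → Inst C′ (pC g G)) (g∘f.map-pBS-inverse C) ∘ Inst-pC inv-pres

  Val-pF : ∀ {c n} (F : Form c n) {γ γ′ : Fin c → CCtx} {θ θ′ : Sub n 0} →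
           γ′ ≗ pC f ∘ γ → θ′ ≗ pSE f ∘ θ → Val γ θ F ⇔ Val γ′ θ′ (pF f F)
  Val-pF (atom G M A) γ≗ θ≗ =
    mk⇔ (Val-atom-pF (fun-injective π) pres wf G M A γ≗ θ≗) (Val-atom-pF⁻¹ G M A γ≗ θ≗)
  Val-pF top          γ≗ θ≗ = ⇔-id _
  Val-pF bot          γ≗ θ≗ = ⇔-id _
  Val-pF (imp F₁ F₂)  γ≗ θ≗ = →-cong-⇔ (Val-pF F₁ γ≗ θ≗) (Val-pF F₂ γ≗ θ≗)
  Val-pF (conj F₁ F₂) γ≗ θ≗ = Val-pF F₁ γ≗ θ≗ ×-⇔ Val-pF F₂ γ≗ θ≗
  Val-pF (disj F₁ F₂) γ≗ θ≗ = Val-pF F₁ γ≗ θ≗ ⊎-⇔ Val-pF F₂ γ≗ θ≗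
  Val-pF (ctxPi C F)  γ≗ θ≗ = mk⇔
    (λ v G′ inst → to (Val-pF F (ext-γ γ≗ (sym (f∘g.pC-inverse G′))) θ≗)
                      (v (pC g G′) (Inst-pC⁻¹ inst)))
    (λ v G inst → from (Val-pF F (ext-γ γ≗ refl) θ≗) (v (pC f G) (Inst-pC pres inst)))
  Val-pF (all α F)    γ≗ θ≗ = mk⇔
    (λ v M′ ⊢M′ → to (Val-pF F γ≗ (ext-θ θ≗ (sym (f∘g.pT-inverse M′))))
                     (v (pT g M′) (ATm-pT inv-pres ⊢M′)))
    (λ v M ⊢M → from (Val-pF F γ≗ (ext-θ θ≗ refl)) (v (pT f M) (ATm-pT pres ⊢M)))
  Val-pF (ex α F)     γ≗ θ≗ = mk⇔
    (λ (M , ⊢M , v) → pT f M , ATm-pT pres ⊢M , to (Val-pF F γ≗ (ext-θ θ≗ refl)) v)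
    (λ (M′ , ⊢M′ , v) → pT g M′ , ATm-pT inv-pres ⊢M′ ,
                        from (Val-pF F γ≗ (ext-θ θ≗ (sym (f∘g.pT-inverse M′)))) v)

theorem3p6 : (Sg : Sig) → WfSig Sg → (F : Form 0 0) → Logic.Closed Sg F →
    (π : Perm) → Logic.Valid Sg F ⇔ Logic.Valid Sg (permF π F)
theorem3p6 Sg wf F _ π = Val-pF wf π F (λ ()) (λ ())
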